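{- For every $n \geq 1$, $\gamma(Q^3_n) \geq \gamma(Q^2_n)$.
   Context: $[n] = \{0,1,\ldots,n-1\}$. The 3D queen graph $Q^3_n$ has vertex set $[n]^3$; distinct $v,w$ are adjacent iff $w-v$ is a nonzero integer multiple of one of $(1,0,0),(0,1,0),(0,0,1)$, $(1,\pm1,0),(1,0,\pm1),(0,1,\pm1)$, $(1,\pm1,\pm1)$. The 2D queen graph $Q^2_n$ has vertex set $[n]^2$; distinct $v,w$ are adjacent iff $w-v$ is a nonzero integer multiple of one of $(1,0),(0,1),(1,1),(1,-1)$. A set $S$ of vertices of a graph is dominating if every vertex is in $S$ or adjacent to a vertex of $S$; $\gamma(G)$ is the minimum size of a dominating set of $G$. -}

module Defs where

open import Level using (0ℓ)
open import Data.Nat using (ℕ; _≤_)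
open import Data.Fin using (Fin; toℕ)
open import Data.Integer using (ℤ; +_; -_; _-_; _*_)
open import Data.Product using (_×_; _,_; ∃; Σ-syntax; ∃-syntax)
open import Data.Sum using (_⊎_)
open import Data.List using (List; []; _∷_; length)
open import Data.List.Membership.Propositional using (_∈_)
open import Data.List.Relation.Unary.Unique.Propositional using (Unique)
open import Relation.Binary.PropositionalEquality using (_≡_)
open import Relation.Nullary using (¬_)

record Graph : Set₁ where
  field
    V   : Set
    Adj : V → V → Set
open Graph public

-- A finite set of vertices is a duplicate-free list; its size is its length.
IsDominating : (G : Graph) → List (V G) → Set
IsDominating G S = ∀ v → v ∈ S ⊎ (∃[ w ] (w ∈ S × Adj G w v))

IsDominationNumber : (G : Graph) → ℕ → Set
IsDominationNumber G k =
  (∃[ S ] (Unique S × IsDominating G S × length S ≡ k)) ×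
  (∀ S → Unique S → IsDominating G S → k ≤ length S)

ι : {n : ℕ} → Fin n → ℤ
ι i = + toℕ i

Dir3 : Set
Dir3 = ℤ × ℤ × ℤ

one : ℤ
one = + 1
mone : ℤ
mone = - (+ 1)
zer : ℤ
zer = + 0

dirs3 : List Dir3
dirs3 = (one , zer , zer) ∷ (zer , one , zer) ∷ (zer , zer , one)
      ∷ (one , one , zer) ∷ (one , mone , zer)
      ∷ (one , zer , one) ∷ (one , zer , mone)
      ∷ (zer , one , one) ∷ (zer , one , mone)
      ∷ (one , one , one) ∷ (one , one , mone)
      ∷ (one , mone , one) ∷ (one , mone , mone) ∷ []

V3 : ℕ → Set
V3 n = Fin n × Fin n × Fin n

Adj3 : (n : ℕ) → V3 n → V3 n → Set
Adj3 n (x , y , z) (x' , y' , z') =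
  ¬ ((x , y , z) ≡ (x' , y' , z')) ×
  (∃[ d ] (d ∈ dirs3 × (∃[ t ] ( ι x' - ι x ≡ t * Data.Product.proj₁ d
                                × ι y' - ι y ≡ t * Data.Product.proj₁ (Data.Product.proj₂ d)
                                × ι z' - ι z ≡ t * Data.Product.proj₂ (Data.Product.proj₂ d)))))

Q3 : ℕ → Graph
Q3 n = record { V = V3 n ; Adj = Adj3 n }

dirs2 : List (ℤ × ℤ)
dirs2 = (one , zer) ∷ (zer , one) ∷ (one , one) ∷ (one , mone) ∷ []

V2 : ℕ → Set
V2 n = Fin n × Fin n

Adj2 : (n : ℕ) → V2 n → V2 n → Set
Adj2 n (x , y) (x' , y') =
  ¬ ((x , y) ≡ (x' , y')) ×
  (∃[ d ] (d ∈ dirs2 × (∃[ t ] ( ι x' - ι x ≡ t * Data.Product.proj₁ d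
                                × ι y' - ι y ≡ t * Data.Product.proj₂ d))))

Q2 : ℕ → Graph
Q2 n = record { V = V2 n ; Adj = Adj2 n }

{-# OPTIONS --safe #-}
-- Forgetting the third coordinate maps Q³ₙ onto Q²ₙ, and every line of Q³ₙ
-- (of any of the 13 directions) projects onto a line of Q²ₙ or onto a single
-- point. Hence the projection of a dominating set of Q³ₙ dominates Q²ₙ, and
-- it is no larger.
module Submission where

open import Defs
open import Data.Nat using (ℕ; _≤_)
open import Data.Nat.Properties using (≤-trans; ≤-reflexive)
open import Data.Fin.Properties using () renaming (_≟_ to _≟ᶠ_)
open import Data.Integer using (ℤ; _*_)
open import Data.Integer.Properties using (*-zeroʳ) renaming (_≟_ to _≟ℤ_)
open import Data.Product using (_×_; _,_; proj₁; proj₂; ∃-syntax)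
open import Data.Product.Properties using (≡-dec)
open import Data.Sum using (_⊎_; inj₁; inj₂)
open import Data.List using (map; deduplicate)
open import Data.List.Properties using (length-map; length-deduplicate)
open import Data.List.Membership.Propositional using (_∈_)
open import Data.List.Membership.Propositional.Properties using (∈-map⁺; ∈-deduplicate⁺)
open import Data.List.Membership.DecPropositional (≡-dec _≟ℤ_ _≟ℤ_) using (_∈?_)
open import Data.List.Relation.Unary.All using (All; all?; lookup)
open import Data.List.Relation.Unary.Any using (here)
open import Data.List.Relation.Unary.Unique.DecPropositional.Properties using (deduplicate-!)
open import Relation.Binary using (DecidableEquality)
open import Relation.Binary.PropositionalEquality using (_≡_; refl; trans; cong; subst)
open import Relation.Nullary using (yes; no)
open import Relation.Nullary.Decidable using (from-yes; _⊎-dec_)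

IsWeakHomomorphism : (G H : Graph) → (V G → V H) → Set
IsWeakHomomorphism G H f = ∀ {u v} → Adj G u v → f u ≡ f v ⊎ Adj H (f u) (f v)

deduplicate-dominating : ∀ {G} (_≟_ : DecidableEquality (V G)) {S} →
                         IsDominating G S → IsDominating G (deduplicate _≟_ S)
deduplicate-dominating _≟_ dom v with dom v
... | inj₁ v∈S             = inj₁ (∈-deduplicate⁺ _≟_ v∈S)
... | inj₂ (w , w∈S , w~v) = inj₂ (w , ∈-deduplicate⁺ _≟_ w∈S , w~v)

module _ {G H : Graph} {f : V G → V H}
         (weak-hom : IsWeakHomomorphism G H f)
         (surjective : ∀ v → ∃[ u ] f u ≡ v) where

  map-dominating : ∀ {S} → IsDominating G S → IsDominating H (map f S)
  map-dominating {S} dom v with surjective v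
  ... | u , refl with dom u
  ...   | inj₁ u∈S = inj₁ (∈-map⁺ f u∈S)
  ...   | inj₂ (w , w∈S , w~u) with weak-hom w~u
  ...     | inj₁ fw≡fu = inj₁ (subst (_∈ map f S) fw≡fu (∈-map⁺ f w∈S))
  ...     | inj₂ fw~fu = inj₂ (f w , ∈-map⁺ f w∈S , fw~fu)

  domination-number-mono : DecidableEquality (V H) → ∀ {k l} →
                           IsDominationNumber G k → IsDominationNumber H l → l ≤ k
  domination-number-mono _≟_ ((S , _ , dom , refl) , _) (_ , minimal) =
    ≤-trans (minimal (deduplicate _≟_ (map f S))
                     (deduplicate-! _≟_ (map f S))
                     (deduplicate-dominating _≟_ (map-dominating dom)))
            (≤-trans (length-deduplicate _≟_ (map f S)) (≤-reflexive (length-map f S)))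

project : Dir3 → ℤ × ℤ
project (a , b , _) = (a , b)

project-dirs3 : All (λ d → project d ≡ (zer , zer) ⊎ project d ∈ dirs2) dirs3
project-dirs3 =
  from-yes (all? (λ d → ≡-dec _≟ℤ_ _≟ℤ_ (project d) (zer , zer) ⊎-dec project d ∈? dirs2) dirs3)

module _ {n : ℕ} where

  forget-height : V3 n → V2 n
  forget-height (x , y , _) = (x , y)

  forget-height-surjective : ∀ v → ∃[ u ] forget-height u ≡ v
  forget-height-surjective (x , y) = (x , y , x) , refl

  forget-height-weak-hom : IsWeakHomomorphism (Q3 n) (Q2 n) forget-height
  forget-height-weak-hom {x , y , _} {x' , y' , _} (_ , d , d∈dirs3 , t , δx , δy , _)
    with ≡-dec _≟ᶠ_ _≟ᶠ_ (x , y) (x' , y') | lookup project-dirs3 d∈dirs3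
  ... | yes same  | _             = inj₁ same
  ... | no  moved | inj₂ d∈dirs2  = inj₂ (moved , project d , d∈dirs2 , t , δx , δy)
  -- only (0,0,1) projects to (0,0); its lines project to the zero multiple of (1,0)
  ... | no  moved | inj₁ vertical =
    inj₂ (moved , (one , zer) , here refl , zer ,
          stationary δx (cong proj₁ vertical) , stationary δy (cong proj₂ vertical))
    where
    stationary : ∀ {δ c} → δ ≡ t * c → c ≡ zer → δ ≡ zer * one
    stationary δ≡tc refl = trans δ≡tc (*-zeroʳ t)

-- the bound needs no 1 ≤ n: for n = 0 both domination numbers are 0
theorem5 : (n : ℕ) → 1 ≤ n → (k3 k2 : ℕ) → IsDominationNumber (Q3 n) k3 → IsDominationNumber (Q2 n) k2 → k2 ≤ k3
theorem5 n _ k3 k2 =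
  domination-number-mono forget-height-weak-hom forget-height-surjective (≡-dec _≟ᶠ_ _≟ᶠ_)
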